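{- \begin{align*} 2\sum_{j=0}^{n-2}f_jf_{j+2}-f_{n-2}f_{n-1}&=f_n^2-1 \quad\text{for all integers } n>1,\\ 2\sum_{j=0}^{n-2}f_jf_{j+2}+f_{n-1}^2&=f_nf_{n+1}-1 \quad\text{for all integers } n>0. \end{align*}
   Context: $f_n=F_{n+1}$, where $F_0=0$, $F_1=1$, $F_m=F_{m-1}+F_{m-2}$ are the Fibonacci numbers. An empty sum is $0$. -}

module Defs where

open import Data.Nat using (ℕ; zero; suc)
open import Data.Integer using (ℤ; +_; _+_; _*_)

F : ℕ → ℕ
F zero = 0
F (suc zero) = 1
F (suc (suc m)) = F (suc m) Data.Nat.+ F m

f : ℕ → ℤ
f n = + F (suc n)

sumBelow : ℕ → (ℕ → ℤ) → ℤ
sumBelow zero g = + 0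
sumBelow (suc k) g = sumBelow k g + g k

-- For any sequence u with u (m+2) = u (m+1) + u m, the quantity
-- 2 Σ_{j<m} u_j u_{j+2} + u_m² − u_{m+1} u_{m+2} does not depend on m: the new summand
-- u_m u_{m+2} exactly compensates the change of the two quadratic terms.  For f its value
-- is f₀² − f₁ f₂ = −1, which is the second identity; the first follows by rewriting
-- u_{m+2}² through the recurrence.
module Submission where

open import Defs
open import Data.Nat using (ℕ; _∸_; _>_; s≤s; suc; zero)
import Data.Nat.Properties as ℕ
open import Data.Integer using (ℤ; +_; _+_; _-_; _*_)
open import Data.Integer.Tactic.RingSolver using (solve-∀)
open import Data.Product using (_×_; _,_)
open import Relation.Binary.PropositionalEquality using (_≡_; refl; sym; trans; cong; cong₂; module ≡-Reasoning)

FibonacciLike : (ℕ → ℤ) → Set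
FibonacciLike u = ∀ m → u (suc (suc m)) ≡ u (suc m) + u m

f-fibonacciLike : FibonacciLike f
f-fibonacciLike m = refl

crossSum : (ℕ → ℤ) → ℕ → ℤ
crossSum u m = sumBelow m (λ j → u j * u (j Data.Nat.+ 2))

crossInvariant : (ℕ → ℤ) → ℕ → ℤ
crossInvariant u m = + 2 * crossSum u m + u m * u m - u (suc m) * u (suc (suc m))

crossInvariant-step : ∀ u → FibonacciLike u → ∀ m → crossInvariant u (suc m) ≡ crossInvariant u m
crossInvariant-step u rec m = begin
  + 2 * (S + a * u (m Data.Nat.+ 2)) + b * b - u (suc (suc m)) * u (suc (suc (suc m)))
    ≡⟨ cong (λ x → + 2 * (S + a * x) + b * b - u (suc (suc m)) * u (suc (suc (suc m))))
            (cong u (ℕ.+-comm m 2)) ⟩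
  + 2 * (S + a * u (suc (suc m))) + b * b - u (suc (suc m)) * u (suc (suc (suc m)))
    ≡⟨ cong₂ (λ x y → + 2 * (S + a * x) + b * b - x * y)
             (rec m) (trans (rec (suc m)) (cong (_+ b) (rec m))) ⟩
  + 2 * (S + a * (b + a)) + b * b - (b + a) * ((b + a) + b)
    ≡⟨ identity S a b ⟩
  + 2 * S + a * a - b * (b + a)
    ≡⟨ cong (λ x → + 2 * S + a * a - b * x) (sym (rec m)) ⟩
  crossInvariant u m ∎
  where
  open ≡-Reasoning
  S = crossSum u m
  a = u m
  b = u (suc m)
  identity : ∀ S a b → + 2 * (S + a * (b + a)) + b * b - (b + a) * ((b + a) + b)
                     ≡ + 2 * S + a * a - b * (b + a)
  identity = solve-∀

crossInvariant-constant : ∀ u → FibonacciLike u → ∀ m → crossInvariant u m ≡ crossInvariant u 0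
crossInvariant-constant u rec zero = refl
crossInvariant-constant u rec (suc m) =
  trans (crossInvariant-step u rec m) (crossInvariant-constant u rec m)

crossSum-plus-square : ∀ u → FibonacciLike u → ∀ m →
  + 2 * crossSum u m + u m * u m ≡ u (suc m) * u (suc (suc m)) + crossInvariant u 0
crossSum-plus-square u rec m =
  trans (moveRight (+ 2 * crossSum u m + u m * u m) (u (suc m) * u (suc (suc m))))
        (cong (_+_ (u (suc m) * u (suc (suc m)))) (crossInvariant-constant u rec m))
  where
  moveRight : ∀ x y → x ≡ y + (x - y)
  moveRight = solve-∀

crossSum-minus-product : ∀ u → FibonacciLike u → ∀ m →
  + 2 * crossSum u (suc m) - u m * u (suc m) ≡ u (suc (suc m)) * u (suc (suc m)) + crossInvariant u 0
crossSum-minus-product u rec m = begin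
  + 2 * T - a * b
    ≡⟨ regroup T a b ⟩
  (+ 2 * T + b * b) - (b * b + a * b)
    ≡⟨ cong (_- (b * b + a * b)) (crossSum-plus-square u rec (suc m)) ⟩
  x * u (suc (suc (suc m))) + c - (b * b + a * b)
    ≡⟨ cong (λ y → x * y + c - (b * b + a * b)) (rec (suc m)) ⟩
  x * (x + b) + c - (b * b + a * b)
    ≡⟨ cong (λ y → y * (y + b) + c - (b * b + a * b)) (rec m) ⟩
  (b + a) * ((b + a) + b) + c - (b * b + a * b)
    ≡⟨ complete a b c ⟩
  (b + a) * (b + a) + c
    ≡⟨ cong (λ y → y * y + c) (sym (rec m)) ⟩
  x * x + c ∎
  where
  open ≡-Reasoning
  T = crossSum u (suc m)
  a = u m
  b = u (suc m)
  x = u (suc (suc m))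
  c = crossInvariant u 0
  regroup : ∀ T a b → + 2 * T - a * b ≡ (+ 2 * T + b * b) - (b * b + a * b)
  regroup = solve-∀
  complete : ∀ a b c → (b + a) * ((b + a) + b) + c - (b * b + a * b) ≡ (b + a) * (b + a) + c
  complete = solve-∀

mainTheorem14 : ((n : ℕ) → n > 1 →
                   (+ 2) * sumBelow (n ∸ 1) (λ j → f j * f (j Data.Nat.+ 2)) - f (n ∸ 2) * f (n ∸ 1)
                     ≡ f n * f n - + 1)
                × ((n : ℕ) → n > 0 →
                   (+ 2) * sumBelow (n ∸ 1) (λ j → f j * f (j Data.Nat.+ 2)) + f (n ∸ 1) * f (n ∸ 1)
                     ≡ f n * f (Data.Nat.suc n) - + 1)
mainTheorem14 = first , second
  where
  first : (n : ℕ) → n > 1 → + 2 * crossSum f (n ∸ 1) - f (n ∸ 2) * f (n ∸ 1) ≡ f n * f n - + 1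
  first (suc zero) (s≤s ())
  first (suc (suc m)) _ = crossSum-minus-product f f-fibonacciLike m
  second : (n : ℕ) → n > 0 → + 2 * crossSum f (n ∸ 1) + f (n ∸ 1) * f (n ∸ 1) ≡ f n * f (suc n) - + 1
  second (suc m) _ = crossSum-plus-square f f-fibonacciLike m
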